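{- Let $G$ be a finite $CP$-group. Then $\mathcal{P}_e(G)$ is a chordal graph and a cograph.
   Context: A finite group is a $CP$-group if every nonidentity element has order a power of a prime. For a finite group $G$, the enhanced power graph $\mathcal{P}_e(G)$ is the simple graph with vertex set $G$ in which two distinct vertices $x,y$ are adjacent if and only if $\langle x,y\rangle$ is cyclic. A graph is chordal if it has no induced cycle of length greater than $3$; it is a cograph if it has no induced subgraph isomorphic to the path $P_4$ on four vertices. -}

module Defs where

open import Level using (Level; _⊔_)
open import Algebra.Bundles using (Group)
open import Data.Nat using (ℕ; zero; suc; _+_; _^_; _≤_; _<_; _%_)
open import Data.Nat.Primality using (Prime)
open import Data.Fin using (Fin; toℕ)
open import Data.List using (List)
open import Data.List.Relation.Unary.Any using (Any)
open import Data.Product using (Σ; ∃; _×_; _,_)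
open import Relation.Nullary using (¬_)
open import Relation.Binary.PropositionalEquality using (_≡_)
open import Function.Bundles using (_⇔_)

module GroupDefs {c ℓ : Level} (G : Group c ℓ) where
  open Group G

  pow : Carrier → ℕ → Carrier
  pow g zero    = ε
  pow g (suc n) = g ∙ pow g n

  IsFinite : Set (c ⊔ ℓ)
  IsFinite = Σ (List Carrier) λ xs → ∀ g → Any (g ≈_) xs

  HasOrder : Carrier → ℕ → Set ℓ
  HasOrder g n = (1 ≤ n) × (pow g n ≈ ε) × (∀ m → 1 ≤ m → m < n → ¬ (pow g m ≈ ε))

  IsCP : Set (c ⊔ ℓ)
  IsCP = ∀ g → ¬ (g ≈ ε) → ∃ λ p → ∃ λ k → Prime p × HasOrder g (p ^ k)

  data ⟨_⟩ (S : Carrier → Set ℓ) : Carrier → Set (c ⊔ ℓ) where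
    gen  : ∀ {g} → S g → ⟨ S ⟩ g
    unit : ⟨ S ⟩ ε
    mul  : ∀ {g h} → ⟨ S ⟩ g → ⟨ S ⟩ h → ⟨ S ⟩ (g ∙ h)
    inv  : ∀ {g} → ⟨ S ⟩ g → ⟨ S ⟩ (g ⁻¹)
    resp : ∀ {g h} → g ≈ h → ⟨ S ⟩ g → ⟨ S ⟩ h

  ⟨_⟩₁ : Carrier → Carrier → Set (c ⊔ ℓ)
  ⟨ x ⟩₁ = ⟨ (λ g → g ≈ x) ⟩

  ⟨_,_⟩₂ : Carrier → Carrier → Carrier → Set (c ⊔ ℓ)
  ⟨ x , y ⟩₂ = ⟨ (λ g → (g ≈ x) ⊎' (g ≈ y)) ⟩
    where
      open import Data.Sum using () renaming (_⊎_ to _⊎'_)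

  CyclicGen₂ : Carrier → Carrier → Set (c ⊔ ℓ)
  CyclicGen₂ x y = Σ Carrier λ z → ⟨ x , y ⟩₂ z × (∀ g → ⟨ x , y ⟩₂ g → ⟨ z ⟩₁ g)

  -- edges of the enhanced power graph
  Adj : Carrier → Carrier → Set (c ⊔ ℓ)
  Adj x y = ¬ (x ≈ y) × CyclicGen₂ x y

  Next : (k : ℕ) → Fin (4 + k) → Fin (4 + k) → Set
  Next k i j = toℕ j ≡ suc (toℕ i) % (4 + k)

  InducedCycle : (k : ℕ) → (Fin (4 + k) → Carrier) → Set (c ⊔ ℓ)
  InducedCycle k v =
    (∀ i j → v i ≈ v j → i ≡ j) ×
    (∀ i j → ¬ (i ≡ j) → (Adj (v i) (v j) ⇔ CycAdj i j))
    where
      open import Data.Sum using (_⊎_)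
      CycAdj : Fin (4 + k) → Fin (4 + k) → Set
      CycAdj i j = Next k i j ⊎ Next k j i

  IsChordal : Set (c ⊔ ℓ)
  IsChordal = ∀ k (v : Fin (4 + k) → Carrier) → ¬ InducedCycle k v

  InducedP4 : Carrier → Carrier → Carrier → Carrier → Set (c ⊔ ℓ)
  InducedP4 a b c' d =
    ¬ (a ≈ b) × ¬ (a ≈ c') × ¬ (a ≈ d) × ¬ (b ≈ c') × ¬ (b ≈ d) × ¬ (c' ≈ d) ×
    Adj a b × Adj b c' × Adj c' d ×
    ¬ Adj a c' × ¬ Adj a d × ¬ Adj b d

  IsCograph : Set (c ⊔ ℓ)
  IsCograph = ∀ a b c' d → ¬ InducedP4 a b c' d

-- The key fact is that the subgroups of a cyclic p-group form a chain. In a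
-- CP-group every element generates a cyclic p-group, so two vertices are
-- adjacent in the enhanced power graph exactly when one lies in the cyclic
-- subgroup generated by the other, and any two elements of a common cyclic
-- subgroup are comparable in this sense. For a path a - b - c - d without the
-- chords ac and bd, orient each edge towards the larger cyclic subgroup: two
-- consecutive edges pointing the same way give a chord by transitivity, and an
-- edge pair meeting at a common larger vertex gives a chord by the chain
-- property. Both an induced P₄ and the first four vertices of an induced cycle
-- of length ≥ 4 are such paths.
module Submission where

open import Defs
open import Level using (Level; _⊔_)
open import Algebra.Bundles using (Group)
open import Data.Empty using (⊥)
open import Data.Fin using (#_)
open import Data.Nat using (ℕ; zero; suc; pred; >-nonZero; _+_; _*_; _^_; NonZero; _%_)
open import Data.Nat.Properties using (*-comm; +-comm; *-suc; suc-pred)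
open import Data.Nat.Divisibility
open import Data.Nat.Primality using (Prime; prime⇒irreducible; prime⇒nonZero)
open import Data.Nat.Coprimality using (Coprime; coprime-divisor)
open import Data.Nat.GCD using (gcd; gcd[m,n]∣m; gcd[m,n]∣n; gcd-GCD; module Bézout)
open import Data.Product using (∃; _×_; _,_)
open import Data.Sum using (_⊎_; inj₁; inj₂; map)
open import Function using (_∘_; case_of_)
open import Function.Bundles using (Equivalence)
open import Relation.Nullary using (¬_; yes; no; contradiction)
open import Relation.Binary.PropositionalEquality as ≡ using (_≡_; _≢_; subst)

private
  variable
    p d e : ℕ

∤-prime⇒coprime : Prime p → p ∤ d → Coprime d p
∤-prime⇒coprime p-prime p∤d (i∣d , i∣p) with prime⇒irreducible p-prime i∣p
... | inj₁ i≡1    = i≡1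
... | inj₂ ≡.refl = contradiction i∣d p∤d

∤-prime∧∣prime^⇒≡1 : ∀ k → Prime p → p ∤ d → d ∣ p ^ k → d ≡ 1
∤-prime∧∣prime^⇒≡1 zero    p-prime p∤d d∣1 = ∣1⇒≡1 d∣1
∤-prime∧∣prime^⇒≡1 (suc k) p-prime p∤d d∣p^k+1 =
  ∤-prime∧∣prime^⇒≡1 k p-prime p∤d (coprime-divisor (∤-prime⇒coprime p-prime p∤d) d∣p^k+1)

∣prime^-total : ∀ k → Prime p → d ∣ p ^ k → e ∣ p ^ k → d ∣ e ⊎ e ∣ d
∣prime^-total {p} {d} {e} k p-prime d∣ e∣ with p ∣? d | p ∣? e
... | no p∤d | _ rewrite ∤-prime∧∣prime^⇒≡1 k p-prime p∤d d∣ = inj₁ (1∣ e)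
... | yes _ | no p∤e rewrite ∤-prime∧∣prime^⇒≡1 k p-prime p∤e e∣ = inj₂ (1∣ d)
∣prime^-total zero p-prime d∣1 _ | yes _ | yes _ rewrite ∣1⇒≡1 d∣1 = inj₁ (1∣ _)
∣prime^-total {p} (suc k) p-prime d∣ e∣ | yes (divides q ≡.refl) | yes (divides r ≡.refl) =
  map (*-monoˡ-∣ {q} {r} p) (*-monoˡ-∣ {r} {q} p) (∣prime^-total k p-prime (cancel d∣) (cancel e∣))
  where
    instance _ = prime⇒nonZero p-prime
    cancel : ∀ {s} → s * p ∣ p * p ^ k → s ∣ p ^ k
    cancel {s} h = *-cancelʳ-∣ p (subst (s * p ∣_) (*-comm p (p ^ k)) h)

module EnhancedPowerGraph {c ℓ : Level} (G : Group c ℓ) where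
  open Group G
  open GroupDefs G
  open import Algebra.Properties.Group G using (inverseˡ-unique; ε⁻¹≈ε)
  import Algebra.Properties.Monoid.Mult monoid as Mult
  open import Relation.Binary.Reasoning.Setoid setoid

  pow≡× : ∀ g n → pow g n ≡ n Mult.× g
  pow≡× g zero    = ≡.refl
  pow≡× g (suc n) = ≡.cong (g ∙_) (pow≡× g n)

  pow-+ : ∀ g m n → pow g (m + n) ≈ pow g m ∙ pow g n
  pow-+ g m n rewrite pow≡× g (m + n) | pow≡× g m | pow≡× g n = Mult.×-homo-+ g m n

  pow-* : ∀ g m n → pow (pow g n) m ≈ pow g (m * n)
  pow-* g m n rewrite pow≡× (pow g n) m | pow≡× g n | pow≡× g (m * n) = Mult.×-assocˡ g m n

  pow-multiple : ∀ {g n} → pow g n ≈ ε → ∀ m → pow g (m * n) ≈ ε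
  pow-multiple         gⁿ≈ε zero    = refl
  pow-multiple {g} {n} gⁿ≈ε (suc m) = begin
    pow g (n + m * n)         ≈⟨ pow-+ g n (m * n) ⟩
    pow g n ∙ pow g (m * n)   ≈⟨ ∙-cong gⁿ≈ε (pow-multiple gⁿ≈ε m) ⟩
    ε ∙ ε                     ≈⟨ identityˡ ε ⟩
    ε                         ∎

  infix 4 _∈⟨_⟩
  _∈⟨_⟩ : Carrier → Carrier → Set (c ⊔ ℓ)
  g ∈⟨ x ⟩ = ⟨ x ⟩₁ g

  ∈⟨⟩-refl : ∀ {x} → x ∈⟨ x ⟩
  ∈⟨⟩-refl = gen refl

  ∈⟨⟩-pow : ∀ {g x} n → g ∈⟨ x ⟩ → pow g n ∈⟨ x ⟩
  ∈⟨⟩-pow zero    g∈ = unit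
  ∈⟨⟩-pow (suc n) g∈ = mul g∈ (∈⟨⟩-pow n g∈)

  ∈⟨⟩-trans : ∀ {g h x} → g ∈⟨ h ⟩ → h ∈⟨ x ⟩ → g ∈⟨ x ⟩
  ∈⟨⟩-trans (gen g≈h)    h∈ = resp (sym g≈h) h∈
  ∈⟨⟩-trans unit         h∈ = unit
  ∈⟨⟩-trans (mul g₁ g₂)  h∈ = mul (∈⟨⟩-trans g₁ h∈) (∈⟨⟩-trans g₂ h∈)
  ∈⟨⟩-trans (inv g∈)     h∈ = inv (∈⟨⟩-trans g∈ h∈)
  ∈⟨⟩-trans (resp eq g∈) h∈ = resp eq (∈⟨⟩-trans g∈ h∈)

  ∈⟨⟩-resp : ∀ {g g′ x x′} → g ≈ g′ → x ≈ x′ → g′ ∈⟨ x′ ⟩ → g ∈⟨ x ⟩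
  ∈⟨⟩-resp g≈g′ x≈x′ g′∈ = ∈⟨⟩-trans (resp (sym g≈g′) g′∈) (gen (sym x≈x′))

  ∈⟨ε⟩⇒≈ε : ∀ {g} → g ∈⟨ ε ⟩ → g ≈ ε
  ∈⟨ε⟩⇒≈ε (gen g≈ε)    = g≈ε
  ∈⟨ε⟩⇒≈ε unit         = refl
  ∈⟨ε⟩⇒≈ε (mul g₁ g₂)  = trans (∙-cong (∈⟨ε⟩⇒≈ε g₁) (∈⟨ε⟩⇒≈ε g₂)) (identityˡ ε)
  ∈⟨ε⟩⇒≈ε (inv g∈)     = trans (⁻¹-cong (∈⟨ε⟩⇒≈ε g∈)) ε⁻¹≈ε
  ∈⟨ε⟩⇒≈ε (resp eq g∈) = trans (sym eq) (∈⟨ε⟩⇒≈ε g∈)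

  ⟨,⟩₂⊆⟨⟩₁ : ∀ {x y z g} → x ∈⟨ z ⟩ → y ∈⟨ z ⟩ → ⟨ x , y ⟩₂ g → g ∈⟨ z ⟩
  ⟨,⟩₂⊆⟨⟩₁ x∈ y∈ (gen (inj₁ g≈x)) = resp (sym g≈x) x∈
  ⟨,⟩₂⊆⟨⟩₁ x∈ y∈ (gen (inj₂ g≈y)) = resp (sym g≈y) y∈
  ⟨,⟩₂⊆⟨⟩₁ x∈ y∈ unit           = unit
  ⟨,⟩₂⊆⟨⟩₁ x∈ y∈ (mul g₁ g₂)    = mul (⟨,⟩₂⊆⟨⟩₁ x∈ y∈ g₁) (⟨,⟩₂⊆⟨⟩₁ x∈ y∈ g₂)
  ⟨,⟩₂⊆⟨⟩₁ x∈ y∈ (inv g∈)       = inv (⟨,⟩₂⊆⟨⟩₁ x∈ y∈ g∈)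
  ⟨,⟩₂⊆⟨⟩₁ x∈ y∈ (resp eq g∈)   = resp eq (⟨,⟩₂⊆⟨⟩₁ x∈ y∈ g∈)

  pow-∣⇒∈⟨pow⟩ : ∀ x {m n} → m ∣ n → pow x n ∈⟨ pow x m ⟩
  pow-∣⇒∈⟨pow⟩ x {m} (divides q ≡.refl) = resp (pow-* x q m) (∈⟨⟩-pow q ∈⟨⟩-refl)

  module Periodic (x : Carrier) (N : ℕ) .{{_ : NonZero N}} (xᴺ≈ε : pow x N ≈ ε) where

    pow⁻¹ : ∀ m → (pow x m) ⁻¹ ≈ pow x (m * pred N)
    pow⁻¹ m = sym (inverseˡ-unique _ _ (begin
      pow x (m * pred N) ∙ pow x m   ≈⟨ pow-+ x (m * pred N) m ⟨
      pow x (m * pred N + m)         ≡⟨ ≡.cong (pow x) m*pred[N]+m≡m*N ⟩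
      pow x (m * N)                  ≈⟨ pow-multiple xᴺ≈ε m ⟩
      ε                              ∎))
      where
        m*pred[N]+m≡m*N : m * pred N + m ≡ m * N
        m*pred[N]+m≡m*N = ≡.trans (+-comm (m * pred N) m)
          (≡.trans (≡.sym (*-suc m (pred N))) (≡.cong (m *_) (suc-pred N)))

    ∈⟨⟩⇒pow : ∀ {g} → g ∈⟨ x ⟩ → ∃ λ m → g ≈ pow x m
    ∈⟨⟩⇒pow (gen g≈x) = 1 , trans g≈x (sym (identityʳ x))
    ∈⟨⟩⇒pow unit      = 0 , refl
    ∈⟨⟩⇒pow (mul g₁ g₂) with ∈⟨⟩⇒pow g₁ | ∈⟨⟩⇒pow g₂
    ... | m₁ , eq₁ | m₂ , eq₂ = m₁ + m₂ , trans (∙-cong eq₁ eq₂) (sym (pow-+ x m₁ m₂))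
    ∈⟨⟩⇒pow (inv g∈) with ∈⟨⟩⇒pow g∈
    ... | m , eq = m * pred N , trans (⁻¹-cong eq) (pow⁻¹ m)
    ∈⟨⟩⇒pow (resp eq g∈) with ∈⟨⟩⇒pow g∈
    ... | m , eq′ = m , trans (sym eq) eq′

    -- Bézout writes gcd m N as ± (a m − b N), and pow x (b N) ≈ ε.
    pow-gcd∈⟨pow⟩ : ∀ m → pow x (gcd m N) ∈⟨ pow x m ⟩
    pow-gcd∈⟨pow⟩ m with Bézout.identity (gcd-GCD m N)
    ... | Bézout.+- a b eq = resp (begin
      pow (pow x m) a                      ≈⟨ pow-* x a m ⟩
      pow x (a * m)                        ≡⟨ ≡.cong (pow x) eq ⟨
      pow x (gcd m N + b * N)              ≈⟨ pow-+ x (gcd m N) (b * N) ⟩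
      pow x (gcd m N) ∙ pow x (b * N)      ≈⟨ ∙-congˡ (pow-multiple xᴺ≈ε b) ⟩
      pow x (gcd m N) ∙ ε                  ≈⟨ identityʳ _ ⟩
      pow x (gcd m N)                      ∎) (∈⟨⟩-pow a ∈⟨⟩-refl)
    ... | Bézout.-+ a b eq = resp (sym (inverseˡ-unique _ _ (begin
      pow x (gcd m N) ∙ pow (pow x m) a    ≈⟨ ∙-congˡ (pow-* x a m) ⟩
      pow x (gcd m N) ∙ pow x (a * m)      ≈⟨ pow-+ x (gcd m N) (a * m) ⟨
      pow x (gcd m N + a * m)              ≡⟨ ≡.cong (pow x) eq ⟩
      pow x (b * N)                        ≈⟨ pow-multiple xᴺ≈ε b ⟩
      ε                                    ∎))) (inv (∈⟨⟩-pow a ∈⟨⟩-refl))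

    gcd-∣⇒∈⟨pow⟩ : ∀ {m k} → gcd m N ∣ gcd k N → pow x k ∈⟨ pow x m ⟩
    gcd-∣⇒∈⟨pow⟩ {m} {k} gcd∣gcd =
      ∈⟨⟩-trans (pow-∣⇒∈⟨pow⟩ x (gcd[m,n]∣m k N))
        (∈⟨⟩-trans (pow-∣⇒∈⟨pow⟩ x gcd∣gcd) (pow-gcd∈⟨pow⟩ m))

    ∈⟨⟩-total : (∀ {d e} → d ∣ N → e ∣ N → d ∣ e ⊎ e ∣ d) →
                ∀ {a b} → a ∈⟨ x ⟩ → b ∈⟨ x ⟩ → a ∈⟨ b ⟩ ⊎ b ∈⟨ a ⟩
    ∈⟨⟩-total ∣N-total a∈ b∈ with ∈⟨⟩⇒pow a∈ | ∈⟨⟩⇒pow b∈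
    ... | m , a≈xᵐ | k , b≈xᵏ =
      map (∈⟨⟩-resp a≈xᵐ b≈xᵏ ∘ gcd-∣⇒∈⟨pow⟩ {k} {m})
          (∈⟨⟩-resp b≈xᵏ a≈xᵐ ∘ gcd-∣⇒∈⟨pow⟩ {m} {k})
          (∣N-total (gcd[m,n]∣n k N) (gcd[m,n]∣n m N))

  Comparable : Carrier → Carrier → Set (c ⊔ ℓ)
  Comparable a b = a ∈⟨ b ⟩ ⊎ b ∈⟨ a ⟩

  comparable⇒adj : ∀ {a b} → ¬ a ≈ b → Comparable a b → Adj a b
  comparable⇒adj a≉b (inj₁ a∈⟨b⟩) = a≉b , _ , gen (inj₂ refl) , λ _ → ⟨,⟩₂⊆⟨⟩₁ a∈⟨b⟩ ∈⟨⟩-refl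
  comparable⇒adj a≉b (inj₂ b∈⟨a⟩) = a≉b , _ , gen (inj₁ refl) , λ _ → ⟨,⟩₂⊆⟨⟩₁ ∈⟨⟩-refl b∈⟨a⟩

  ChordlessPath₄ : Carrier → Carrier → Carrier → Carrier → Set (c ⊔ ℓ)
  ChordlessPath₄ a₀ a₁ a₂ a₃ =
    Adj a₀ a₁ × Adj a₁ a₂ × Adj a₂ a₃ × ¬ a₀ ≈ a₂ × ¬ Adj a₀ a₂ × ¬ a₁ ≈ a₃ × ¬ Adj a₁ a₃

  inducedP4⇒chordlessPath₄ : ∀ {a₀ a₁ a₂ a₃} → InducedP4 a₀ a₁ a₂ a₃ → ChordlessPath₄ a₀ a₁ a₂ a₃
  inducedP4⇒chordlessPath₄ (_ , a₀≉a₂ , _ , _ , a₁≉a₃ , _ , a₀a₁ , a₁a₂ , a₂a₃ , ¬a₀a₂ , _ , ¬a₁a₃) =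
    a₀a₁ , a₁a₂ , a₂a₃ , a₀≉a₂ , ¬a₀a₂ , a₁≉a₃ , ¬a₁a₃

  inducedCycle⇒chordlessPath₄ : ∀ {k v} → InducedCycle k v →
                                ChordlessPath₄ (v (# 0)) (v (# 1)) (v (# 2)) (v (# 3))
  inducedCycle⇒chordlessPath₄ {k} {v} (v-injective , adj⇔) =
    edge (# 0) (# 1) (λ ()) ≡.refl , edge (# 1) (# 2) (λ ()) ≡.refl , edge (# 2) (# 3) (λ ()) ≡.refl ,
    (λ v₀≈v₂ → case v-injective _ _ v₀≈v₂ of λ ()) ,
    (λ v₀v₂ → case Equivalence.to (adj⇔ _ _ (λ ())) v₀v₂ of λ { (inj₁ ()) ; (inj₂ ()) }) ,
    (λ v₁≈v₃ → case v-injective _ _ v₁≈v₃ of λ ()) ,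
    (λ v₁v₃ → case Equivalence.to (adj⇔ _ _ (λ ())) v₁v₃ of λ { (inj₁ ()) ; (inj₂ eq) → 1≢4%[4+k] k eq })
    where
      edge : ∀ i j → i ≢ j → Next k i j → Adj (v i) (v j)
      edge i j i≢j i→j = Equivalence.from (adj⇔ i j i≢j) (inj₁ i→j)

      1≢4%[4+k] : ∀ k → 1 ≢ 4 % (4 + k)
      1≢4%[4+k] zero    ()
      1≢4%[4+k] (suc k) ()

  module _ (cp : IsCP) where

    ∈⟨⟩-total-≉ε : ∀ {x a b} → ¬ x ≈ ε → a ∈⟨ x ⟩ → b ∈⟨ x ⟩ → Comparable a b
    ∈⟨⟩-total-≉ε {x} x≉ε with cp x x≉ε
    ... | p , k , p-prime , 1≤pᵏ , xᵖᵏ≈ε , _ =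
      Periodic.∈⟨⟩-total x (p ^ k) {{>-nonZero 1≤pᵏ}} xᵖᵏ≈ε (∣prime^-total k p-prime)

    -- Only doubly negated, since x ≈ ε need not be decidable.
    ∈⟨⟩-¬¬total : ∀ {x a b} → a ∈⟨ x ⟩ → b ∈⟨ x ⟩ → ¬ ¬ Comparable a b
    ∈⟨⟩-¬¬total {x} {a} a∈ b∈ ¬comparable = ¬comparable (∈⟨⟩-total-≉ε x≉ε a∈ b∈)
      where
        x≉ε : ¬ x ≈ ε
        x≉ε x≈ε = ¬comparable (inj₁ (resp (sym a≈ε) unit))
          where
            a≈ε : a ≈ ε
            a≈ε = ∈⟨ε⟩⇒≈ε (∈⟨⟩-resp refl (sym x≈ε) a∈)

    adj⇒¬¬comparable : ∀ {a b} → Adj a b → ¬ ¬ Comparable a b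
    adj⇒¬¬comparable (_ , _ , _ , ⟨a,b⟩⊆⟨z⟩) =
      ∈⟨⟩-¬¬total (⟨a,b⟩⊆⟨z⟩ _ (gen (inj₁ refl))) (⟨a,b⟩⊆⟨z⟩ _ (gen (inj₂ refl)))

    ¬comparable-chordlessPath₄ : ∀ {a₀ a₁ a₂ a₃} →
      Comparable a₀ a₁ → Comparable a₁ a₂ → Comparable a₂ a₃ →
      ¬ Comparable a₀ a₂ → ¬ Comparable a₁ a₃ → ⊥
    ¬comparable-chordlessPath₄ (inj₁ a₀∈) (inj₁ a₁∈) _           ¬a₀a₂ _     = ¬a₀a₂ (inj₁ (∈⟨⟩-trans a₀∈ a₁∈))
    ¬comparable-chordlessPath₄ (inj₂ a₁∈) (inj₂ a₂∈) _           ¬a₀a₂ _     = ¬a₀a₂ (inj₂ (∈⟨⟩-trans a₂∈ a₁∈))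
    ¬comparable-chordlessPath₄ _          (inj₁ a₁∈) (inj₁ a₂∈)  _     ¬a₁a₃ = ¬a₁a₃ (inj₁ (∈⟨⟩-trans a₁∈ a₂∈))
    ¬comparable-chordlessPath₄ _          (inj₂ a₂∈) (inj₂ a₃∈)  _     ¬a₁a₃ = ¬a₁a₃ (inj₂ (∈⟨⟩-trans a₃∈ a₂∈))
    ¬comparable-chordlessPath₄ (inj₁ a₀∈) (inj₂ a₂∈) _           ¬a₀a₂ _     = ∈⟨⟩-¬¬total a₀∈ a₂∈ ¬a₀a₂
    ¬comparable-chordlessPath₄ _          (inj₁ a₁∈) (inj₂ a₃∈)  _     ¬a₁a₃ = ∈⟨⟩-¬¬total a₁∈ a₃∈ ¬a₁a₃

    ¬chordlessPath₄ : ∀ {a₀ a₁ a₂ a₃} → ¬ ChordlessPath₄ a₀ a₁ a₂ a₃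
    ¬chordlessPath₄ (a₀a₁ , a₁a₂ , a₂a₃ , a₀≉a₂ , ¬a₀a₂ , a₁≉a₃ , ¬a₁a₃) =
      adj⇒¬¬comparable a₀a₁ λ c₀₁ → adj⇒¬¬comparable a₁a₂ λ c₁₂ → adj⇒¬¬comparable a₂a₃ λ c₂₃ →
      ¬comparable-chordlessPath₄ c₀₁ c₁₂ c₂₃
        (¬a₀a₂ ∘ comparable⇒adj a₀≉a₂) (¬a₁a₃ ∘ comparable⇒adj a₁≉a₃)

proposition4p8 : ∀ {c ℓ : Level} (G : Group c ℓ) →
    GroupDefs.IsFinite G → GroupDefs.IsCP G →
    GroupDefs.IsChordal G × GroupDefs.IsCograph G
proposition4p8 G _ cp =
  (λ _ _ cycle → ¬chordlessPath₄ cp (inducedCycle⇒chordlessPath₄ cycle)) ,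
  (λ _ _ _ _ path → ¬chordlessPath₄ cp (inducedP4⇒chordlessPath₄ path))
  where open EnhancedPowerGraph G
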